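{- For all compositions $\alpha,\beta$, $$\mathcal{K}_{\alpha*0*\beta}(x_1,\dots,x_{\ell(\alpha)+\ell(\beta)+1})\big|_{x_{\ell(\alpha)+1}=0}=\mathcal{K}_{\alpha*\beta}(x_1,\dots,x_{\ell(\alpha)},x_{\ell(\alpha)+2},\dots,x_{\ell(\alpha)+\ell(\beta)+1}).$$
   Context: Compositions are finite sequences of nonnegative integers, $\ell$ is length, $*$ is concatenation. $\xi_if=\frac{x_if-x_{i+1}s_if}{x_i-x_{i+1}}$ with $s_i$ swapping $x_i,x_{i+1}$. Key polynomials $\mathcal{K}_\alpha(x_1,\dots,x_n)$, $\alpha\in\mathbb{Z}_{\ge0}^n$, are the unique polynomials with $\mathcal{K}_\alpha=x^\alpha$ if $\alpha_1\ge\cdots\ge\alpha_n$ and $\mathcal{K}_{s_i\alpha}=\xi_i\mathcal{K}_\alpha$ whenever $\alpha_i>\alpha_{i+1}$. -}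

module Defs where

open import Data.Nat using (ℕ; zero; suc; _≤_; _<_)
open import Data.Integer using (ℤ; _+_; _*_; -_; _^_) renaming (_-_ to _⊖ℤ_)
open import Data.Fin using (Fin; zero; suc; inject₁; _≟_) renaming (_≤_ to _≤ᶠ_)
open import Data.Vec using (Vec; []; _∷_; lookup; tabulate)
open import Relation.Nullary using (yes; no)
open import Relation.Binary.PropositionalEquality using (_≡_)

-- Polynomials with integer coefficients in n variables x_1,...,x_n,
-- represented syntactically (variable x_{j+1} is  var j, j : Fin n).
data Poly (n : ℕ) : Set where
  var  : Fin n → Poly n
  con  : ℤ → Poly n
  _⊕_  : Poly n → Poly n → Poly n
  _⊗_  : Poly n → Poly n → Poly n
  ⊝_   : Poly n → Poly n

infixl 6 _⊕_ _⊖_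
infixl 7 _⊗_

_⊖_ : ∀ {n} → Poly n → Poly n → Poly n
p ⊖ q = p ⊕ (⊝ q)

eval : ∀ {n} → Poly n → Vec ℤ n → ℤ
eval (var j) x = lookup x j
eval (con c) x = c
eval (p ⊕ q) x = eval p x + eval q x
eval (p ⊗ q) x = eval p x * eval q x
eval (⊝ p)   x = - eval p x

-- Equality of polynomials.  Since ℤ is an infinite integral domain, two
-- integer polynomials are equal iff they agree at every integer point.
_≈_ : ∀ {n} → Poly n → Poly n → Set
p ≈ q = ∀ x → eval p x ≡ eval q x

rename : ∀ {n} → (Fin n → Fin n) → Poly n → Poly n
rename σ (var j) = var (σ j)
rename σ (con c) = con c
rename σ (p ⊕ q) = rename σ p ⊕ rename σ q
rename σ (p ⊗ q) = rename σ p ⊗ rename σ q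
rename σ (⊝ p)   = ⊝ rename σ p

transp : ∀ {n} → Fin n → Fin n → Fin n → Fin n
transp a b j with j ≟ a
... | yes _ = b
... | no _ with j ≟ b
...   | yes _ = a
...   | no _ = j

sᶠ : ∀ {n} → Fin n → Fin (suc n) → Fin (suc n)
sᶠ i = transp (inject₁ i) (suc i)

swapVec : ∀ {n} {A : Set} → Fin n → Vec A (suc n) → Vec A (suc n)
swapVec i α = tabulate (λ j → lookup α (sᶠ i j))

sPoly : ∀ {n} → Fin n → Poly (suc n) → Poly (suc n)
sPoly i = rename (sᶠ i)

monomial : ∀ {n} → Vec ℕ n → Poly n
monomial {zero} [] = con (Data.Integer.+ 1)
monomial {suc n} (a ∷ α) = pow (var zero) a ⊗ shift (monomial α)
  where
  pow : ∀ {m} → Poly m → ℕ → Poly m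
  pow p zero = con (Data.Integer.+ 1)
  pow p (suc k) = p ⊗ pow p k
  shift : ∀ {m} → Poly m → Poly (suc m)
  shift (var j) = var (suc j)
  shift (con c) = con c
  shift (p ⊕ q) = shift p ⊕ shift q
  shift (p ⊗ q) = shift p ⊗ shift q
  shift (⊝ p)   = ⊝ shift p

Dominant : ∀ {n} → Vec ℕ n → Set
Dominant {n} α = (i j : Fin n) → i ≤ᶠ j → lookup α j ≤ lookup α i

-- The Demazure operator ξ_i f = (x_i f - x_{i+1} s_i f)/(x_i - x_{i+1})
-- is an exact division, so  K_{s_i α} = ξ_i K_α  is expressed as
-- (x_i - x_{i+1}) K_{s_i α} = x_i K_α - x_{i+1} s_i K_α.
record IsKeyFamily (K : (n : ℕ) → Vec ℕ n → Poly n) : Set where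
  field
    dominant : ∀ n (α : Vec ℕ n) → Dominant α → K n α ≈ monomial α
    demazure : ∀ n (α : Vec ℕ (suc n)) (i : Fin n) →
               lookup α (suc i) < lookup α (inject₁ i) →
               ((var (inject₁ i) ⊖ var (suc i)) ⊗ K (suc n) (swapVec i α))
                 ≈ (var (inject₁ i) ⊗ K (suc n) α ⊖ var (suc i) ⊗ sPoly i (K (suc n) α))

-- Induction on the moment Σᵢ i·γᵢ of γ = α * 0 * β, simultaneously for all positions of the zero.
-- If γ is dominant, so is α * β, and both sides are monomials.  Otherwise γ has an ascent
-- γᵢ < γᵢ₊₁.  Evaluating the Demazure relation for sᵢγ (of smaller moment) at a point that
-- vanishes at the zero of γ yields (yₐ − g(y))·(lhs − rhs) = 0 with g independent of yₐ: if the
-- ascent starts at the zero, g = 0; otherwise sᵢ commutes with inserting the zero, and the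
-- Demazure relation for α * β is used as well.  The linear factor cancels at every integer
-- point y because polynomials preserve congruences: moving yₐ by t changes nothing modulo t, so
-- lhs − rhs at y is divisible by every t that moves y off the hyperplane yₐ = g(y).
module Submission where

module ZeroInsertion where

  open import Defs
  open import Data.Empty using (⊥-elim)
  open import Data.Fin as Fin using (Fin; zero; suc; inject₁; _≟_; fromℕ; _↑ˡ_)
  open import Data.Fin.Properties using (punchIn-mono-≤; <⇒≢; ≤̄⇒inject₁<)
  import Data.Fin.Properties as Fin
  open import Data.Integer as ℤ using (ℤ; _+_; _*_; -_; _-_; _^_; +_; 0ℤ; -1ℤ; ∣_∣)
  open import Data.Integer.Base using (≢-nonZero)
  open import Data.Integer.Divisibility.Signed using (_∣_; divides; ∣⇒∣ᵤ; ∣m∣n⇒∣m+n; ∣m⇒∣-m; ∣n⇒∣m*n; ∣m⇒∣m*n)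
  open import Data.Integer.Properties as ℤ
    using (*-identityˡ; +-identityʳ; +-inverseʳ; *-cancelˡ-≡; ∣i∣≡0⇒i≡0; ∣-i∣≡∣i∣; i≡j⇒i-j≡0; i-j≡0⇒i≡j)
  open import Data.Integer.Tactic.RingSolver using (solve-∀)
  open import Data.Nat as ℕ using (ℕ; zero; suc; s≤s; z≤n; _<_; _≤_; _<?_)
  open import Data.Nat.Divisibility using (>⇒∤) renaming (_∣_ to _∣ℕ_)
  open import Data.Nat.Induction using (<-wellFounded)
  import Data.Nat.Properties as ℕ
  open import Data.Product using (∃; _,_)
  open import Data.Sum using (_⊎_; inj₁; inj₂)
  open import Data.Vec as Vec using (Vec; []; _∷_; _++_; lookup; _[_]≔_; insertAt; cast)
  open import Data.Vec.Properties
    using (cast-is-id; insertAt-punchIn; insertAt-lookup; lookup∘update; lookup∘update′;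
           lookup∘tabulate; tabulate∘lookup; tabulate-cong)
  open import Data.Vec.Relation.Binary.Pointwise.Inductive as Pointwise using (Pointwise; _∷_)
  open import Function using (_∘_)
  open import Induction.WellFounded using (Acc; acc)
  open import Relation.Binary.Core using (REL; Rel; _Preserves_⟶_)
  open import Relation.Binary.Definitions using (Reflexive)
  open import Relation.Binary.PropositionalEquality
  open import Relation.Nullary using (yes; no)
  open import Algebra.Properties.AbelianGroup ℤ.+-0-abelianGroup using (inverseˡ-unique)
  open import Algebra.Properties.CommutativeSemigroup ℕ.+-commutativeSemigroup using (x∙yz≈y∙xz)

  module _ {a b ℓ} {A : Set a} {B : Set b} {R : REL A B ℓ} where

    insertAt⁺ : ∀ {n} {x : Vec A n} {y : Vec B n} (j : Fin (suc n)) {u v} →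
                Pointwise R x y → R u v → Pointwise R (insertAt x j u) (insertAt y j v)
    insertAt⁺ zero    x∼y           u∼v = u∼v ∷ x∼y
    insertAt⁺ (suc j) (x₀∼y₀ ∷ x∼y) u∼v = x₀∼y₀ ∷ insertAt⁺ j x∼y u∼v

  module _ {a ℓ} {A : Set a} {R : Rel A ℓ} (R-refl : Reflexive R) where

    []≔⁺ : ∀ {n} (x : Vec A n) (j : Fin n) {v} → R (lookup x j) v → Pointwise R x (x [ j ]≔ v)
    []≔⁺ (x₀ ∷ x) zero    x₀∼v = x₀∼v ∷ Pointwise.refl R-refl
    []≔⁺ (x₀ ∷ x) (suc j) x₀∼v = R-refl ∷ []≔⁺ x j x₀∼v

  infix 4 _≡_[mod_]

  -- A record rather than a synonym for d ∣ a - b, so that a and b can be inferred from it.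
  record _≡_[mod_] (a b d : ℤ) : Set where
    constructor congruent
    field divides-difference : d ∣ a - b

  ≡-mod-refl : ∀ {d a} → a ≡ a [mod d ]
  ≡-mod-refl {a = a} = congruent (divides 0ℤ (+-inverseʳ a))

  ≡-mod-+ : ∀ a t → a ≡ a + t [mod t ]
  ≡-mod-+ a t = congruent (divides -1ℤ (identity a t))
    where
    identity : ∀ a t → a - (a + t) ≡ -1ℤ * t
    identity = solve-∀

  +-cong-mod : ∀ {d a a′ b b′} → a ≡ a′ [mod d ] → b ≡ b′ [mod d ] → a + b ≡ a′ + b′ [mod d ]
  +-cong-mod {a = a} {a′} {b} {b′} (congruent p) (congruent q) =
    congruent (subst (_ ∣_) (identity a a′ b b′) (∣m∣n⇒∣m+n p q))
    where
    identity : ∀ a a′ b b′ → (a - a′) + (b - b′) ≡ (a + b) - (a′ + b′)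
    identity = solve-∀

  *-cong-mod : ∀ {d a a′ b b′} → a ≡ a′ [mod d ] → b ≡ b′ [mod d ] → a * b ≡ a′ * b′ [mod d ]
  *-cong-mod {a = a} {a′} {b} {b′} (congruent p) (congruent q) =
    congruent (subst (_ ∣_) (identity a a′ b b′) (∣m∣n⇒∣m+n (∣n⇒∣m*n a q) (∣m⇒∣m*n b′ p)))
    where
    identity : ∀ a a′ b b′ → a * (b - b′) + (a - a′) * b′ ≡ a * b - a′ * b′
    identity = solve-∀

  -‿cong-mod : ∀ {d a a′} → a ≡ a′ [mod d ] → - a ≡ - a′ [mod d ]
  -‿cong-mod {a = a} {a′} (congruent p) = congruent (subst (_ ∣_) (identity a a′) (∣m⇒∣-m p))
    where
    identity : ∀ a a′ → - (a - a′) ≡ - a - - a′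
    identity = solve-∀

  PreservesCongruences : ∀ {n} → (Vec ℤ n → ℤ) → Set
  PreservesCongruences F = ∀ d → F Preserves Pointwise (_≡_[mod d ]) ⟶ _≡_[mod d ]

  eval-preservesCongruences : ∀ {n} (p : Poly n) → PreservesCongruences (eval p)
  eval-preservesCongruences (var j) d x≡y = Pointwise.lookup x≡y j
  eval-preservesCongruences (con c) d x≡y = ≡-mod-refl
  eval-preservesCongruences (p ⊕ q) d x≡y =
    +-cong-mod (eval-preservesCongruences p d x≡y) (eval-preservesCongruences q d x≡y)
  eval-preservesCongruences (p ⊗ q) d x≡y =
    *-cong-mod (eval-preservesCongruences p d x≡y) (eval-preservesCongruences q d x≡y)
  eval-preservesCongruences (⊝ p) d x≡y = -‿cong-mod (eval-preservesCongruences p d x≡y)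

  ∘insertAt-preservesCongruences : ∀ {n} {F : Vec ℤ (suc n) → ℤ} (j : Fin (suc n)) z →
                                   PreservesCongruences F → PreservesCongruences (λ y → F (insertAt y j z))
  ∘insertAt-preservesCongruences j z F-pres d y≡y′ = F-pres d (insertAt⁺ j y≡y′ ≡-mod-refl)

  -‿preservesCongruences : ∀ {n} {F G : Vec ℤ n → ℤ} → PreservesCongruences F → PreservesCongruences G →
                          PreservesCongruences (λ y → F y - G y)
  -‿preservesCongruences F-pres G-pres d y≡y′ = +-cong-mod (F-pres d y≡y′) (-‿cong-mod (G-pres d y≡y′))

  ∣∧∣i∣<⇒≡0 : ∀ {t h} → + t ∣ h → ∣ h ∣ < t → h ≡ 0ℤ
  ∣∧∣i∣<⇒≡0 {t} {h} t∣h ∣h∣<t with ∣ h ∣ in ∣h∣≡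
  ... | zero  = ∣i∣≡0⇒i≡0 ∣h∣≡
  ... | suc _ = ⊥-elim (>⇒∤ ∣h∣<t (subst (t ∣ℕ_) ∣h∣≡ (∣⇒∣ᵤ t∣h)))

  ∣i∣<⇒i+t≢0 : ∀ {t} i → ∣ i ∣ < t → i + + t ≢ 0ℤ
  ∣i∣<⇒i+t≢0 {t} i ∣i∣<t i+t≡0 =
    ℕ.<⇒≢ ∣i∣<t (trans (cong ∣_∣ (inverseˡ-unique i (+ t) i+t≡0)) (∣-i∣≡∣i∣ (+ t)))

  vanishes-off-hyperplane⇒vanishes :
    ∀ {n} {H : Vec ℤ n → ℤ} → PreservesCongruences H →
    (a : Fin n) (g : Vec ℤ n → ℤ) → (∀ y v → g (y [ a ]≔ v) ≡ g y) →
    (∀ y → lookup y a - g y ≢ 0ℤ → H y ≡ 0ℤ) → ∀ y → H y ≡ 0ℤ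
  vanishes-off-hyperplane⇒vanishes {n} {H} H-pres a g g-indep H-off y =
    ∣∧∣i∣<⇒≡0 t∣Hy (s≤s (ℕ.m≤m+n ∣ H y ∣ ∣ w y ∣))
    where
    w : Vec ℤ n → ℤ
    w x = lookup x a - g x
    t : ℕ
    t = suc (∣ H y ∣ ℕ.+ ∣ w y ∣)
    y′ : Vec ℤ n
    y′ = y [ a ]≔ (lookup y a + + t)
    w-y′ : w y′ ≡ w y + + t
    w-y′ = begin
      lookup y′ a - g y′        ≡⟨ cong₂ _-_ (lookup∘update a y _) (g-indep y _) ⟩
      (lookup y a + + t) - g y  ≡⟨ identity (lookup y a) (+ t) (g y) ⟩
      w y + + t                 ∎
      where
      open ≡-Reasoning
      identity : ∀ l t g → (l + t) - g ≡ (l - g) + t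
      identity = solve-∀
    Hy′≡0 : H y′ ≡ 0ℤ
    Hy′≡0 = H-off y′ (subst (_≢ 0ℤ) (sym w-y′) (∣i∣<⇒i+t≢0 (w y) (s≤s (ℕ.m≤n+m ∣ w y ∣ ∣ H y ∣))))
    t∣Hy : + t ∣ H y
    t∣Hy = subst (+ t ∣_) (trans (cong (λ h → H y - h) Hy′≡0) (+-identityʳ (H y)))
                 (_≡_[mod_].divides-difference (H-pres (+ t) ([]≔⁺ ≡-mod-refl y a (≡-mod-+ (lookup y a) (+ t)))))

  cancel-linear-factor :
    ∀ {n} {F G : Vec ℤ n → ℤ} → PreservesCongruences F → PreservesCongruences G →
    (a : Fin n) (g : Vec ℤ n → ℤ) → (∀ y v → g (y [ a ]≔ v) ≡ g y) →
    (∀ y → (lookup y a - g y) * F y ≡ (lookup y a - g y) * G y) → ∀ y → F y ≡ G y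
  cancel-linear-factor {F = F} {G} F-pres G-pres a g g-indep factor-eq y =
    i-j≡0⇒i≡j (F y) (G y)
      (vanishes-off-hyperplane⇒vanishes (-‿preservesCongruences F-pres G-pres) a g g-indep off-hyperplane y)
    where
    off-hyperplane : ∀ x → lookup x a - g x ≢ 0ℤ → F x - G x ≡ 0ℤ
    off-hyperplane x w≢0 =
      i≡j⇒i-j≡0 (*-cancelˡ-≡ (lookup x a - g x) (F x) (G x) {{≢-nonZero w≢0}} (factor-eq x))

  swap : ∀ {A : Set} {n} → Fin n → Vec A (suc n) → Vec A (suc n)
  swap zero    (a ∷ b ∷ v) = b ∷ a ∷ v
  swap (suc i) (a ∷ v)     = a ∷ swap i v

  swap-involutive : ∀ {A : Set} {n} (i : Fin n) (v : Vec A (suc n)) → swap i (swap i v) ≡ v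
  swap-involutive zero    (a ∷ b ∷ v) = refl
  swap-involutive (suc i) (a ∷ v)     = cong (a ∷_) (swap-involutive i v)

  lookup-swap-inject₁ : ∀ {A : Set} {n} (i : Fin n) (v : Vec A (suc n)) →
                        lookup (swap i v) (inject₁ i) ≡ lookup v (suc i)
  lookup-swap-inject₁ zero    (a ∷ b ∷ v) = refl
  lookup-swap-inject₁ (suc i) (a ∷ v)     = lookup-swap-inject₁ i v

  lookup-swap-suc : ∀ {A : Set} {n} (i : Fin n) (v : Vec A (suc n)) →
                    lookup (swap i v) (suc i) ≡ lookup v (inject₁ i)
  lookup-swap-suc zero    (a ∷ b ∷ v) = refl
  lookup-swap-suc (suc i) (a ∷ v)     = lookup-swap-suc i v

  transp-suc : ∀ {n} (a b j : Fin n) → transp (suc a) (suc b) (suc j) ≡ suc (transp a b j)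
  transp-suc a b j with j ≟ a
  ... | yes _ = refl
  ... | no _ with j ≟ b
  ...   | yes _ = refl
  ...   | no _  = refl

  lookup-sᶠ : ∀ {A : Set} {n} (i : Fin n) (v : Vec A (suc n)) j → lookup v (sᶠ i j) ≡ lookup (swap i v) j
  lookup-sᶠ zero    (a ∷ b ∷ v) zero          = refl
  lookup-sᶠ zero    (a ∷ b ∷ v) (suc zero)    = refl
  lookup-sᶠ zero    (a ∷ b ∷ v) (suc (suc j)) = refl
  lookup-sᶠ (suc i) (a ∷ v)     zero          = refl
  lookup-sᶠ (suc i) (a ∷ v)     (suc j) rewrite transp-suc (inject₁ i) (suc i) j = lookup-sᶠ i v j

  swapVec≡swap : ∀ {A : Set} {n} (i : Fin n) (v : Vec A (suc n)) → swapVec i v ≡ swap i v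
  swapVec≡swap i v = trans (tabulate-cong (lookup-sᶠ i v)) (tabulate∘lookup (swap i v))

  eval-rename : ∀ {n} (σ : Fin n → Fin n) (p : Poly n) x →
                eval (rename σ p) x ≡ eval p (Vec.tabulate (lookup x ∘ σ))
  eval-rename σ (var j) x = sym (lookup∘tabulate (lookup x ∘ σ) j)
  eval-rename σ (con c) x = refl
  eval-rename σ (p ⊕ q) x = cong₂ _+_ (eval-rename σ p x) (eval-rename σ q x)
  eval-rename σ (p ⊗ q) x = cong₂ _*_ (eval-rename σ p x) (eval-rename σ q x)
  eval-rename σ (⊝ p)   x = cong -_ (eval-rename σ p x)

  eval-sPoly : ∀ {n} (i : Fin n) (p : Poly (suc n)) x → eval (sPoly i p) x ≡ eval p (swap i x)
  eval-sPoly i p x = trans (eval-rename (sᶠ i) p x) (cong (eval p) (swapVec≡swap i x))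

  swap-insertAt-inject₁ : ∀ {A : Set} {n} (i : Fin n) (v : Vec A n) z →
                          swap i (insertAt v (inject₁ i) z) ≡ insertAt v (suc i) z
  swap-insertAt-inject₁ zero    (a ∷ v) z = refl
  swap-insertAt-inject₁ (suc i) (a ∷ v) z = cong (a ∷_) (swap-insertAt-inject₁ i v z)

  lookup-insertAt-inject₁ : ∀ {A : Set} {n} (i : Fin n) (v : Vec A n) z →
                            lookup (insertAt v (inject₁ i) z) (suc i) ≡ lookup v i
  lookup-insertAt-inject₁ zero    (a ∷ v) z = refl
  lookup-insertAt-inject₁ (suc i) (a ∷ v) z = lookup-insertAt-inject₁ i v z

  -- i′ is the index of the transposition sᵢ once position j is deleted.
  record SwapAvoids {m} (i : Fin (suc m)) (j : Fin (suc (suc m))) : Set₁ where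
    field
      i′             : Fin m
      swap-insertAt  : ∀ {A : Set} (v : Vec A (suc m)) z → swap i (insertAt v j z) ≡ insertAt (swap i′ v) j z
      lookup-inject₁ : ∀ {A : Set} (v : Vec A (suc m)) z → lookup (insertAt v j z) (inject₁ i) ≡ lookup v (inject₁ i′)
      lookup-suc     : ∀ {A : Set} (v : Vec A (suc m)) z → lookup (insertAt v j z) (suc i) ≡ lookup v (suc i′)

  swapAvoids : ∀ {m} (i : Fin (suc m)) (j : Fin (suc (suc m))) → inject₁ i ≢ j → suc i ≢ j → SwapAvoids i j
  swapAvoids zero zero       i≢j _     = ⊥-elim (i≢j refl)
  swapAvoids zero (suc zero) _   i+1≢j = ⊥-elim (i+1≢j refl)
  swapAvoids {suc m} zero (suc (suc j)) _ _ = record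
    { i′             = zero
    ; swap-insertAt  = λ { (a ∷ b ∷ v) z → refl }
    ; lookup-inject₁ = λ { (a ∷ b ∷ v) z → refl }
    ; lookup-suc     = λ { (a ∷ b ∷ v) z → refl }
    }
  swapAvoids {suc m} (suc i) zero _ _ = record
    { i′             = i
    ; swap-insertAt  = λ v z → refl
    ; lookup-inject₁ = λ v z → refl
    ; lookup-suc     = λ v z → refl
    }
  swapAvoids {suc m} (suc i) (suc j) i≢j i+1≢j = record
    { i′             = suc i′
    ; swap-insertAt  = λ { (a ∷ v) z → cong (a ∷_) (swap-insertAt v z) }
    ; lookup-inject₁ = λ { (a ∷ v) z → lookup-inject₁ v z }
    ; lookup-suc     = λ { (a ∷ v) z → lookup-suc v z }
    }
    where open SwapAvoids (swapAvoids i j (i≢j ∘ cong suc) (i+1≢j ∘ cong suc))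

  ++-∷≡insertAt : ∀ {A : Set} {m k} (α : Vec A m) (β : Vec A k) z →
                  cast (ℕ.+-suc m k) (α ++ z ∷ β) ≡ insertAt (α ++ β) (fromℕ m ↑ˡ k) z
  ++-∷≡insertAt []      β z = cast-is-id refl (z ∷ β)
  ++-∷≡insertAt (a ∷ α) β z = cong (a ∷_) (++-∷≡insertAt α β z)

  AscentAt : ∀ {n} → Vec ℕ (suc n) → Fin n → Set
  AscentAt v i = lookup v (inject₁ i) < lookup v (suc i)

  -- moment v = Σⱼ j · vⱼ, positions counted from 0.
  moment : ∀ {n} → Vec ℕ n → ℕ
  moment []      = 0
  moment (a ∷ v) = moment v ℕ.+ Vec.sum v

  sum-swap : ∀ {n} (i : Fin n) (v : Vec ℕ (suc n)) → Vec.sum (swap i v) ≡ Vec.sum v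
  sum-swap zero    (a ∷ b ∷ v) = x∙yz≈y∙xz b a (Vec.sum v)
  sum-swap (suc i) (a ∷ v)     = cong (a ℕ.+_) (sum-swap i v)

  moment-swap-< : ∀ {n} (i : Fin n) (v : Vec ℕ (suc n)) → AscentAt v i → moment (swap i v) < moment v
  moment-swap-< zero    (a ∷ b ∷ v) a<b =
    ℕ.+-monoʳ-< (moment v ℕ.+ Vec.sum v) (ℕ.+-monoˡ-< (Vec.sum v) a<b)
  moment-swap-< (suc i) (a ∷ v) asc rewrite sum-swap i v = ℕ.+-monoˡ-< (Vec.sum v) (moment-swap-< i v asc)

  dominant-∷ : ∀ {n a} {v : Vec ℕ (suc n)} → lookup v zero ≤ a → Dominant v → Dominant (a ∷ v)
  dominant-∷ v₀≤a dom zero    zero    _         = ℕ.≤-refl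
  dominant-∷ v₀≤a dom zero    (suc k) _         = ℕ.≤-trans (dom zero k z≤n) v₀≤a
  dominant-∷ v₀≤a dom (suc i) (suc k) (s≤s i≤k) = dom i k i≤k

  ascent-or-dominant : ∀ {n} (v : Vec ℕ (suc n)) → ∃ (AscentAt v) ⊎ Dominant v
  ascent-or-dominant (a ∷ []) = inj₂ λ { zero zero _ → ℕ.≤-refl }
  ascent-or-dominant (a ∷ b ∷ v) with a <? b
  ... | yes a<b = inj₁ (zero , a<b)
  ... | no a≮b with ascent-or-dominant (b ∷ v)
  ...   | inj₁ (i , asc) = inj₁ (suc i , asc)
  ...   | inj₂ dom       = inj₂ (dominant-∷ (ℕ.≮⇒≥ a≮b) dom)

  dominant-insertAt⁻ : ∀ {n} (v : Vec ℕ n) j z → Dominant (insertAt v j z) → Dominant v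
  dominant-insertAt⁻ v j z dom i k i≤k =
    subst₂ _≤_ (insertAt-punchIn v j z k) (insertAt-punchIn v j z i) (dom _ _ (punchIn-mono-≤ j i k i≤k))

  -- `monomial` is built from a power function and a variable shift that are local to its
  -- definition and lambda-lifted over the clause variables, so they cannot be named here.
  -- Their evaluation is proved for all functions obeying their defining equations; in
  -- `monomial-∷` a with-abstraction over monomial γ, the exponent b and the lifted parameter
  -- suc b turns their instantiation into a pattern unification problem.

  record IsShift {m} (S : Poly m → Poly (suc m)) : Set where
    field
      shift-var : ∀ {j} → S (var j) ≡ var (suc j)
      shift-con : ∀ {c} → S (con c) ≡ con c
      shift-⊕   : ∀ {p q} → S (p ⊕ q) ≡ S p ⊕ S q
      shift-⊗   : ∀ {p q} → S (p ⊗ q) ≡ S p ⊗ S q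
      shift-⊝   : ∀ {p} → S (⊝ p) ≡ ⊝ S p

  module _ {m} {S : Poly m → Poly (suc m)} (isShift : IsShift S) where
    open IsShift isShift

    eval-shift : ∀ p c y → eval (S p) (c ∷ y) ≡ eval p y
    eval-shift (var j) c y rewrite shift-var {j} = refl
    eval-shift (con d) c y rewrite shift-con {d} = refl
    eval-shift (p ⊕ q) c y rewrite shift-⊕ {p} {q} = cong₂ _+_ (eval-shift p c y) (eval-shift q c y)
    eval-shift (p ⊗ q) c y rewrite shift-⊗ {p} {q} = cong₂ _*_ (eval-shift p c y) (eval-shift q c y)
    eval-shift (⊝ p)   c y rewrite shift-⊝ {p} = cong -_ (eval-shift p c y)

  record IsPower {m} (Q : ℕ → Poly (suc m)) : Set where
    field
      power-zero : Q zero ≡ con (+ 1)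
      power-suc  : ∀ {k} → Q (suc k) ≡ var zero ⊗ Q k

  eval-power : ∀ {m} {Q : ℕ → Poly (suc m)} → IsPower Q → ∀ k c y → eval (Q k) (c ∷ y) ≡ c ^ k
  eval-power isPower zero    c y rewrite IsPower.power-zero isPower = refl
  eval-power isPower (suc k) c y rewrite IsPower.power-suc isPower {k} = cong (c *_) (eval-power isPower k c y)

  record Evaluates {m} (q : Poly (suc m)) (f : ℤ → Vec ℤ m → ℤ) : Set where
    field eval-∷ : ∀ c y → eval q (c ∷ y) ≡ f c y

  evaluates-zero : ∀ {m} {S : Poly m → Poly (suc m)} → IsShift S →
                   ∀ p → Evaluates (con (+ 1) ⊗ S p) (λ c y → c ^ 0 * eval p y)
  evaluates-zero isShift p = record { eval-∷ = λ c y → cong (+ 1 *_) (eval-shift isShift p c y) }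

  evaluates-suc : ∀ {m} {S : Poly m → Poly (suc m)} {Q : ℕ → Poly (suc m)} → IsShift S → IsPower Q →
                  ∀ k p → Evaluates ((var zero ⊗ Q k) ⊗ S p) (λ c y → c ^ suc k * eval p y)
  evaluates-suc isShift isPower k p = record
    { eval-∷ = λ c y → cong₂ _*_ (cong (c *_) (eval-power isPower k c y)) (eval-shift isShift p c y) }

  monomial-∷ : ∀ {n} a (γ : Vec ℕ n) → Evaluates (monomial (a ∷ γ)) (λ c y → c ^ a * eval (monomial γ) y)
  monomial-∷ zero γ
    with evaluates-zero (record { shift-var = refl ; shift-con = refl ; shift-⊕ = refl
                                ; shift-⊗ = refl ; shift-⊝ = refl })
       | monomial γ
  ... | evaluates | P = evaluates P
  monomial-∷ (suc b) γ
    with (λ (X : ℕ) → evaluates-suc (record { shift-var = refl ; shift-con = refl ; shift-⊕ = refl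
                                             ; shift-⊗ = refl ; shift-⊝ = refl })
                                    (record { power-zero = refl ; power-suc = refl }))
       | b | suc b | monomial γ
  ... | evaluates | k | X | P = evaluates X k P

  eval-monomial-∷ : ∀ {n} a (γ : Vec ℕ n) c y → eval (monomial (a ∷ γ)) (c ∷ y) ≡ c ^ a * eval (monomial γ) y
  eval-monomial-∷ a γ = Evaluates.eval-∷ (monomial-∷ a γ)

  eval-monomial-insertAt-0 : ∀ {n} (δ : Vec ℕ n) (j : Fin (suc n)) y →
                             eval (monomial (insertAt δ j 0)) (insertAt y j 0ℤ) ≡ eval (monomial δ) y
  eval-monomial-insertAt-0 δ       zero    y       = trans (eval-monomial-∷ 0 δ 0ℤ y) (*-identityˡ _)
  eval-monomial-insertAt-0 (d ∷ δ) (suc j) (c ∷ y) = begin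
    eval (monomial (d ∷ insertAt δ j 0)) (c ∷ insertAt y j 0ℤ) ≡⟨ eval-monomial-∷ d (insertAt δ j 0) c _ ⟩
    c ^ d * eval (monomial (insertAt δ j 0)) (insertAt y j 0ℤ) ≡⟨ cong (c ^ d *_) (eval-monomial-insertAt-0 δ j y) ⟩
    c ^ d * eval (monomial δ) y                                 ≡⟨ eval-monomial-∷ d δ c y ⟨
    eval (monomial (d ∷ δ)) (c ∷ y)                             ∎
    where open ≡-Reasoning

  module KeyFamily (K : (n : ℕ) → Vec ℕ n → Poly n) (isKey : IsKeyFamily K) where
    open IsKeyFamily isKey

    demazure-ascent : ∀ {n} (γ : Vec ℕ (suc n)) (i : Fin n) → AscentAt γ i →
                      ∀ x {a b A B} → lookup x (inject₁ i) ≡ a → lookup x (suc i) ≡ b →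
                      eval (K _ (swap i γ)) x ≡ A → eval (K _ (swap i γ)) (swap i x) ≡ B →
                      (a - b) * eval (K _ γ) x ≡ a * A - b * B
    demazure-ascent {n} γ i asc x refl refl refl refl = begin
      (xᵢ - xᵢ₊₁) * eval (K _ γ) x                             ≡⟨ cong (λ β → (xᵢ - xᵢ₊₁) * eval (K _ β) x) swap-back ⟨
      (xᵢ - xᵢ₊₁) * eval (K _ (swapVec i γ′)) x                ≡⟨ demazure n γ′ i descent x ⟩
      xᵢ * eval (K _ γ′) x - xᵢ₊₁ * eval (sPoly i (K _ γ′)) x  ≡⟨ cong (λ v → xᵢ * eval (K _ γ′) x - xᵢ₊₁ * v)
                                                                       (eval-sPoly i (K _ γ′) x) ⟩
      xᵢ * eval (K _ γ′) x - xᵢ₊₁ * eval (K _ γ′) (swap i x)   ∎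
      where
      open ≡-Reasoning
      xᵢ xᵢ₊₁ : ℤ
      xᵢ   = lookup x (inject₁ i)
      xᵢ₊₁ = lookup x (suc i)
      γ′ : Vec ℕ (suc n)
      γ′ = swap i γ
      swap-back : swapVec i γ′ ≡ γ
      swap-back = trans (swapVec≡swap i γ′) (swap-involutive i γ)
      descent : lookup γ′ (suc i) < lookup γ′ (inject₁ i)
      descent = subst₂ _<_ (sym (lookup-swap-suc i γ)) (sym (lookup-swap-inject₁ i γ)) asc

    ZeroInsertion : ∀ {n} → Vec ℕ n → Fin (suc n) → Set
    ZeroInsertion {n} δ j = ∀ y → eval (K (suc n) (insertAt δ j 0)) (insertAt y j 0ℤ) ≡ eval (K n δ) y

    zeroInsertion-dominant : ∀ {n} (δ : Vec ℕ n) j → Dominant (insertAt δ j 0) → ZeroInsertion δ j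
    zeroInsertion-dominant {n} δ j dom y = begin
      eval (K (suc n) (insertAt δ j 0)) (insertAt y j 0ℤ) ≡⟨ dominant (suc n) _ dom _ ⟩
      eval (monomial (insertAt δ j 0)) (insertAt y j 0ℤ)  ≡⟨ eval-monomial-insertAt-0 δ j y ⟩
      eval (monomial δ) y                                 ≡⟨ dominant n δ (dominant-insertAt⁻ δ j 0 dom) y ⟨
      eval (K n δ) y                                      ∎
      where open ≡-Reasoning

    zeroInsertion-inject₁ : ∀ {n} (δ : Vec ℕ n) (i : Fin n) → AscentAt (insertAt δ (inject₁ i) 0) i →
                            ZeroInsertion δ (suc i) → ZeroInsertion δ (inject₁ i)
    zeroInsertion-inject₁ {n} δ i asc IH =
      cancel-linear-factor F-pres (eval-preservesCongruences (K n δ)) i (λ _ → 0ℤ) (λ _ _ → refl) factor-eq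
      where
      γ : Vec ℕ (suc n)
      γ = insertAt δ (inject₁ i) 0
      F : Vec ℤ n → ℤ
      F y = eval (K (suc n) γ) (insertAt y (inject₁ i) 0ℤ)
      F-pres : PreservesCongruences F
      F-pres = ∘insertAt-preservesCongruences (inject₁ i) 0ℤ (eval-preservesCongruences (K (suc n) γ))
      factor-eq : ∀ y → (lookup y i - 0ℤ) * F y ≡ (lookup y i - 0ℤ) * eval (K n δ) y
      factor-eq y = begin
        (yᵢ - 0ℤ) * F y                  ≡⟨ negate yᵢ (F y) ⟩
        - ((0ℤ - yᵢ) * F y)              ≡⟨ cong -_ (demazure-ascent γ i asc x (insertAt-lookup y (inject₁ i) 0ℤ)
                                                                      (lookup-insertAt-inject₁ i y 0ℤ) refl swapped) ⟩
        - (0ℤ * A - yᵢ * eval (K n δ) y) ≡⟨ drop-zero yᵢ A (eval (K n δ) y) ⟩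
        (yᵢ - 0ℤ) * eval (K n δ) y       ∎
        where
        open ≡-Reasoning
        yᵢ : ℤ
        yᵢ = lookup y i
        x : Vec ℤ (suc n)
        x = insertAt y (inject₁ i) 0ℤ
        A : ℤ
        A = eval (K (suc n) (swap i γ)) x
        swapped : eval (K (suc n) (swap i γ)) (swap i x) ≡ eval (K n δ) y
        swapped = trans (cong₂ (λ β z → eval (K (suc n) β) z)
                               (swap-insertAt-inject₁ i δ 0) (swap-insertAt-inject₁ i y 0ℤ))
                        (IH y)
        negate : ∀ c f → (c - 0ℤ) * f ≡ - ((0ℤ - c) * f)
        negate = solve-∀
        drop-zero : ∀ c a g → - (0ℤ * a - c * g) ≡ (c - 0ℤ) * g
        drop-zero = solve-∀

    zeroInsertion-swap : ∀ {m} (δ : Vec ℕ (suc m)) j (i : Fin (suc m)) (avoids : SwapAvoids i j) →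
                         AscentAt (insertAt δ j 0) i →
                         ZeroInsertion (swap (SwapAvoids.i′ avoids) δ) j → ZeroInsertion δ j
    zeroInsertion-swap {m} δ j i avoids asc IH =
      cancel-linear-factor F-pres (eval-preservesCongruences (K (suc m) δ))
                           (inject₁ i′) (λ y → lookup y (suc i′)) (λ y v → lookup∘update′ suc≢inject₁ y v) factor-eq
      where
      open SwapAvoids avoids
      γ : Vec ℕ (suc (suc m))
      γ = insertAt δ j 0
      δ′ : Vec ℕ (suc m)
      δ′ = swap i′ δ
      F : Vec ℤ (suc m) → ℤ
      F y = eval (K (suc (suc m)) γ) (insertAt y j 0ℤ)
      F-pres : PreservesCongruences F
      F-pres = ∘insertAt-preservesCongruences j 0ℤ (eval-preservesCongruences (K (suc (suc m)) γ))
      suc≢inject₁ : suc i′ ≢ inject₁ i′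
      suc≢inject₁ = ≢-sym (<⇒≢ (≤̄⇒inject₁< Fin.≤-refl))
      asc′ : AscentAt δ i′
      asc′ = subst₂ _<_ (lookup-inject₁ δ 0) (lookup-suc δ 0) asc
      factor-eq : ∀ y → (lookup y (inject₁ i′) - lookup y (suc i′)) * F y
                        ≡ (lookup y (inject₁ i′) - lookup y (suc i′)) * eval (K (suc m) δ) y
      factor-eq y = begin
        (yᵢ - yᵢ₊₁) * F y
          ≡⟨ demazure-ascent γ i asc x (lookup-inject₁ y 0ℤ) (lookup-suc y 0ℤ)
               (trans (cong (λ β → eval (K _ β) x) (swap-insertAt δ 0)) (IH y))
               (trans (cong₂ (λ β z → eval (K _ β) z) (swap-insertAt δ 0) (swap-insertAt y 0ℤ)) (IH (swap i′ y))) ⟩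
        yᵢ * eval (K (suc m) δ′) y - yᵢ₊₁ * eval (K (suc m) δ′) (swap i′ y)
          ≡⟨ demazure-ascent δ i′ asc′ y refl refl refl refl ⟨
        (yᵢ - yᵢ₊₁) * eval (K (suc m) δ) y ∎
        where
        open ≡-Reasoning
        x : Vec ℤ (suc (suc m))
        x = insertAt y j 0ℤ
        yᵢ yᵢ₊₁ : ℤ
        yᵢ   = lookup y (inject₁ i′)
        yᵢ₊₁ = lookup y (suc i′)

    zeroInsertion-ascent : ∀ {n} (δ : Vec ℕ n) j (i : Fin n) → AscentAt (insertAt δ j 0) i →
                           (∀ (δ′ : Vec ℕ n) j′ → moment (insertAt δ′ j′ 0) < moment (insertAt δ j 0) →
                              ZeroInsertion δ′ j′) →
                           ZeroInsertion δ j
    zeroInsertion-ascent {suc m} δ j i asc IH with inject₁ i ≟ j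
    ... | yes refl = zeroInsertion-inject₁ δ i asc (IH δ (suc i) moment-<)
      where
      γ : Vec ℕ (suc (suc m))
      γ = insertAt δ (inject₁ i) 0
      moment-< : moment (insertAt δ (suc i) 0) < moment γ
      moment-< = subst (λ v → moment v < moment γ) (swap-insertAt-inject₁ i δ 0) (moment-swap-< i γ asc)
    ... | no i≢j with suc i ≟ j
    ...   | yes refl =
      ⊥-elim (ℕ.n≮0 (subst (lookup (insertAt δ (suc i) 0) (inject₁ i) <_) (insertAt-lookup δ (suc i) 0) asc))
    ...   | no i+1≢j = zeroInsertion-swap δ j i avoids asc (IH (swap i′ δ) j moment-<)
      where
      avoids : SwapAvoids i j
      avoids = swapAvoids i j i≢j i+1≢j
      open SwapAvoids avoids
      γ : Vec ℕ (suc (suc m))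
      γ = insertAt δ j 0
      moment-< : moment (insertAt (swap i′ δ) j 0) < moment γ
      moment-< = subst (λ v → moment v < moment γ) (swap-insertAt δ 0) (moment-swap-< i γ asc)

    zeroInsertion-acc : ∀ {n} (δ : Vec ℕ n) j → Acc _<_ (moment (insertAt δ j 0)) → ZeroInsertion δ j
    zeroInsertion-acc δ j (acc smaller) with ascent-or-dominant (insertAt δ j 0)
    ... | inj₂ dom       = zeroInsertion-dominant δ j dom
    ... | inj₁ (i , asc) = zeroInsertion-ascent δ j i asc (λ δ′ j′ lt → zeroInsertion-acc δ′ j′ (smaller lt))

    zeroInsertion : ∀ {n} (δ : Vec ℕ n) j → ZeroInsertion δ j
    zeroInsertion δ j = zeroInsertion-acc δ j (<-wellFounded _)

    eval-K-cast : ∀ {a b} (a≡b : a ≡ b) u x → eval (K a u) x ≡ eval (K b (cast a≡b u)) (cast a≡b x)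
    eval-K-cast refl u x = sym (cong₂ (λ v z → eval (K _ v) z) (cast-is-id refl u) (cast-is-id refl x))

open import Defs
open import Data.Nat using (ℕ; suc; _+_)
open import Data.Nat.Properties using (+-suc)
open import Data.Integer using (ℤ; 0ℤ)
open import Data.Fin using (Fin; fromℕ; _↑ˡ_)
open import Data.Vec using (Vec; _∷_; _++_; insertAt; cast)
open import Relation.Binary.PropositionalEquality using (_≡_; cong₂; module ≡-Reasoning)
open ZeroInsertion using (++-∷≡insertAt; module KeyFamily)

mainTheorem9 : (K : (n : ℕ) → Vec ℕ n → Poly n) → IsKeyFamily K →
               ∀ m k (α : Vec ℕ m) (β : Vec ℕ k) (p : Vec ℤ m) (q : Vec ℤ k) →
                 eval (K (m + suc k) (α ++ 0 ∷ β)) (p ++ 0ℤ ∷ q)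
                   ≡ eval (K (m + k) (α ++ β)) (p ++ q)
mainTheorem9 K isKey m k α β p q = begin
  eval (K (m + suc k) (α ++ 0 ∷ β)) (p ++ 0ℤ ∷ q)                             ≡⟨ eval-K-cast (+-suc m k) _ _ ⟩
  eval (K (suc (m + k)) (cast (+-suc m k) (α ++ 0 ∷ β))) (cast (+-suc m k) (p ++ 0ℤ ∷ q))
    ≡⟨ cong₂ (λ v z → eval (K _ v) z) (++-∷≡insertAt α β 0) (++-∷≡insertAt p q 0ℤ) ⟩
  eval (K (suc (m + k)) (insertAt (α ++ β) j 0)) (insertAt (p ++ q) j 0ℤ) ≡⟨ zeroInsertion (α ++ β) j (p ++ q) ⟩
  eval (K (m + k) (α ++ β)) (p ++ q)                                          ∎
  where
  open ≡-Reasoning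
  open KeyFamily K isKey
  j : Fin (suc (m + k))
  j = fromℕ m ↑ˡ k
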